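{- Let $r$ be a positive integer and $m$ a nonnegative integer. Then $\kappa_r(m)<0$ if and only if $m\ge 1+\sum_{i=1}^{r}\binom{2i-1}{i}$.
   Context: Every nonnegative integer $m$ has a unique $r$-binomial representation $m=\sum_{i=t}^{r}\binom{a_i}{i}$ with $a_r>a_{r-1}>\dots>a_t\ge t\ge1$ (empty sum for $m=0$). The Kruskal–Katona function is $\kappa_r(m):=\sum_{i=t}^{r}\binom{a_i}{i-1}-m$; by the Kruskal–Katona theorem this equals $|\Delta F_{n,r}(m)|-m$ for any $n$ with $m\le\binom{n}{r}$, where $F_{n,r}(m)$ is the family of the first $m$ $r$-subsets of $\{1,\dots,n\}$ in squashed order and $\Delta$ denotes the shadow (all $(r-1)$-sets contained in some member). -}

module Defs where

open import Data.Nat using (ℕ; zero; suc; _+_; _*_; _∸_; _≤?_)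
open import Data.Nat.Combinatorics using (_C_)
open import Data.Integer as ℤ using (ℤ; +_; _-_)
open import Data.List using (List; []; _∷_; map)
open import Data.Nat.ListAction using (sum)
open import Data.Product using (_×_; _,_)
open import Relation.Nullary using (yes; no)

largestA : ℕ → ℕ → ℕ → ℕ
largestA r m zero = zero
largestA r m (suc b) with (suc b) C r ≤? m
... | yes _ = suc b
... | no  _ = largestA r m b

-- The r-binomial representation of m, as the list of pairs (i , a_i),
-- i = r, r-1, ..., t, with m = Σ (a_i C i).  Computed greedily:
-- a_r is the largest a with (a C r) ≤ m (a search bound of m + r suffices),
-- then recurse on (r-1, m - (a_r C r)); stop when the remainder is 0.
binRep : ℕ → ℕ → List (ℕ × ℕ)
binRep zero m = []
binRep (suc k) zero = []
binRep (suc k) (suc n) =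
  let a = largestA (suc k) (suc n) (suc n + suc k)
  in (suc k , a) ∷ binRep k (suc n ∸ (a C suc k))

κ : ℕ → ℕ → ℤ
κ r m = (+ sum (map (λ { (i , a) → a C (i ∸ 1) }) (binRep r m))) - (+ m)

sumCentral : ℕ → ℕ
sumCentral zero = zero
sumCentral (suc j) = sumCentral j + ((2 * j + 1) C suc j)

-- Write m = C(a, r) + m' greedily, with m' < C(a, r-1); the shadow is then
-- C(a, r-1) + shadow_{r-1}(m'), and everything is decided by a against 2r-1.
-- If a < 2r-1, a normalized-matching (LYM) inequality gives shadow ≥ m.
-- If a = 2r-1, then C(a, r-1) = C(a, r), so κ_r(m) = κ_{r-1}(m') and induction on r applies.
-- If a ≥ 2r, then κ_{r-1}(m') is at most the sum of the first r-1 Catalan numbers,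
-- which is below the r-th Catalan number C(2r, r) - C(2r, r-1) ≤ C(a, r) - C(a, r-1).
-- The three cases match the threshold because
-- C(2r-1, r) ≤ Σ_{i≤r} C(2i-1, i) < C(2r, r).

module Submission where

open import Defs
open import Data.Nat using (ℕ; suc; _≤_)
open import Data.Integer using (+_) renaming (_<_ to _<ℤ_)
open import Function.Bundles using (_⇔_)

open import Data.Nat using (zero; _+_; _*_; _∸_; _<_; _≤?_; _≤′_; ≤′-refl; ≤′-step; z≤n; s≤s)
open import Data.Nat.Properties
open import Data.Nat.Combinatorics using (_C_; k>n⇒nCk≡0; nC1≡n; nCk≡nC[n∸k]; nCk+nC[k+1]≡[n+1]C[k+1])
open import Data.Nat.Tactic.RingSolver using (solve-∀)
open import Function.Base using (_∘_)
open import Relation.Binary.PropositionalEquality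
open import Relation.Nullary using (yes; no; contradiction)
open import Relation.Binary.Definitions using (tri<; tri≈; tri>)
open import Data.Product using (_×_; _,_)
open import Data.List using (map)
open import Data.List.Properties using (map-cong)
open import Data.Nat.ListAction using (sum)
open import Function.Bundles using (mk⇔)
import Function.Properties.Equivalence as ⇔
open import Data.Integer as ℤ using (_-_)
import Data.Integer.Properties as ℤP

+-cancelˡ-<-⇔ : ∀ x {y z} → x + y < x + z ⇔ y < z
+-cancelˡ-<-⇔ x = mk⇔ (+-cancelˡ-< x _ _) (+-monoʳ-< x)

[+m]-[+n]<0⇔m<n : ∀ m n → + m - + n <ℤ + 0 ⇔ m < n
[+m]-[+n]<0⇔m<n m n = mk⇔ to from
  where
  to : + m - + n <ℤ + 0 → m < n
  to m-n<0 = ≰⇒> λ n≤m → ℤP.<⇒≱ m-n<0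
    (subst (+ 0 ℤ.≤_) (sym (trans (ℤP.[+m]-[+n]≡m⊖n m n) (ℤP.⊖-≥ n≤m))) (ℤ.+≤+ z≤n))
  from : m < n → + m - + n <ℤ + 0
  from m<n = subst₂ _<ℤ_ (sym (ℤP.[+m]-[+n]≡m⊖n m n)) (ℤP.n⊖n≡0 n) (ℤP.⊖-monoˡ-< n m<n)

pascal : ∀ n k → suc n C suc k ≡ n C k + n C suc k
pascal n k = sym (nCk+nC[k+1]≡[n+1]C[k+1] n k)

nCk≤[1+n]Ck : ∀ n k → n C k ≤ suc n C k
nCk≤[1+n]Ck n zero = ≤-refl
nCk≤[1+n]Ck n (suc k) = subst (n C suc k ≤_) (sym (pascal n k)) (m≤n+m (n C suc k) (n C k))

C-monoˡ-≤ : ∀ k {m n} → m ≤ n → m C k ≤ n C k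
C-monoˡ-≤ k = go ∘ ≤⇒≤′
  where
  go : ∀ {m n} → m ≤′ n → m C k ≤ n C k
  go ≤′-refl = ≤-refl
  go {n = suc n} (≤′-step m≤′n) = ≤-trans (go m≤′n) (nCk≤[1+n]Ck n k)

[k+j]Ck≡[k+j]Cj : ∀ k j → (k + j) C k ≡ (k + j) C j
[k+j]Ck≡[k+j]Cj k j = trans (nCk≡nC[n∸k] (m≤m+n k j)) (cong ((k + j) C_) (m+n∸m≡n k j))

[1+k]*[1+n]C[1+k]≡[1+n]*nCk : ∀ n k → suc k * (suc n C suc k) ≡ suc n * (n C k)
[1+k]*[1+n]C[1+k]≡[1+n]*nCk zero zero = refl
[1+k]*[1+n]C[1+k]≡[1+n]*nCk zero (suc k)
  rewrite k>n⇒nCk≡0 {1} {suc (suc k)} (s≤s (s≤s z≤n)) | k>n⇒nCk≡0 {0} {suc k} (s≤s z≤n) = *-zeroʳ (suc (suc k))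
[1+k]*[1+n]C[1+k]≡[1+n]*nCk (suc n) zero = trans (+-identityʳ _) (trans (nC1≡n (suc (suc n))) (sym (*-identityʳ _)))
[1+k]*[1+n]C[1+k]≡[1+n]*nCk (suc n) (suc k) = begin
    suc (suc k) * (suc (suc n) C suc (suc k))  ≡⟨ cong (suc (suc k) *_) (pascal (suc n) (suc k)) ⟩
    suc (suc k) * (t + w)                      ≡⟨ distribute k t w ⟩
    suc k * t + t + suc (suc k) * w            ≡⟨ cong₂ (λ x y → x + t + y) ([1+k]*[1+n]C[1+k]≡[1+n]*nCk n k) ([1+k]*[1+n]C[1+k]≡[1+n]*nCk n (suc k)) ⟩
    suc n * (n C k) + t + suc n * (n C suc k)  ≡⟨ collect n t (n C k) (n C suc k) ⟩
    suc n * (n C k + n C suc k) + t            ≡⟨ cong (λ x → suc n * x + t) (sym (pascal n k)) ⟩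
    suc n * t + t                              ≡⟨ +-comm (suc n * t) t ⟩
    suc (suc n) * t                            ∎
  where
  open ≡-Reasoning
  t = suc n C suc k
  w = suc n C suc (suc k)
  distribute : ∀ k t w → suc (suc k) * (t + w) ≡ suc k * t + t + suc (suc k) * w
  distribute = solve-∀
  collect : ∀ n t u v → suc n * u + t + suc n * v ≡ suc n * (u + v) + t
  collect = solve-∀

[1+k]*nC[1+k]≡[n∸k]*nCk : ∀ n k → suc k * (n C suc k) ≡ (n ∸ k) * (n C k)
[1+k]*nC[1+k]≡[n∸k]*nCk n k = begin
  suc k * X                              ≡⟨ m+n∸m≡n (suc k * Y) (suc k * X) ⟨
  suc k * Y + suc k * X ∸ suc k * Y      ≡⟨ cong (_∸ suc k * Y) (*-distribˡ-+ (suc k) Y X) ⟨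
  suc k * (Y + X) ∸ suc k * Y            ≡⟨ cong (λ z → suc k * z ∸ suc k * Y) (pascal n k) ⟨
  suc k * (suc n C suc k) ∸ suc k * Y    ≡⟨ cong (_∸ suc k * Y) ([1+k]*[1+n]C[1+k]≡[1+n]*nCk n k) ⟩
  suc n * Y ∸ suc k * Y                  ≡⟨ *-distribʳ-∸ Y (suc n) (suc k) ⟨
  (n ∸ k) * Y                            ∎
  where
  open ≡-Reasoning
  X = n C suc k
  Y = n C k

1+2k≤n⇒nCk≤nC[1+k] : ∀ k {n} → suc (k + k) ≤ n → n C k ≤ n C suc k
1+2k≤n⇒nCk≤nC[1+k] k {n} 1+2k≤n = *-cancelˡ-≤ (suc k) (begin
  suc k * (n C k)        ≤⟨ *-monoˡ-≤ (n C k) (m+n≤o⇒m≤o∸n (suc k) 1+2k≤n) ⟩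
  (n ∸ k) * (n C k)      ≡⟨ [1+k]*nC[1+k]≡[n∸k]*nCk n k ⟨
  suc k * (n C suc k)    ∎)
  where open ≤-Reasoning

n≤1+2k⇒nC[1+k]≤nCk : ∀ k {n} → n ≤ suc (k + k) → n C suc k ≤ n C k
n≤1+2k⇒nC[1+k]≤nCk k {n} n≤1+2k = *-cancelˡ-≤ (suc k) (begin
  suc k * (n C suc k)    ≡⟨ [1+k]*nC[1+k]≡[n∸k]*nCk n k ⟩
  (n ∸ k) * (n C k)      ≤⟨ *-monoˡ-≤ (n C k) (m≤n+o⇒m∸n≤o n k (≤-trans n≤1+2k (≤-reflexive (sym (+-suc k k))))) ⟩
  suc k * (n C k)        ∎)
  where open ≤-Reasoning

[1+2k]Ck≡[1+2k]C[1+k] : ∀ k → suc (k + k) C k ≡ suc (k + k) C suc k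
[1+2k]Ck≡[1+2k]C[1+k] k = subst (λ n → n C k ≡ n C suc k) (+-suc k k) ([k+j]Ck≡[k+j]Cj k (suc k))

[2+2k]Ck≡[2+2k]C[2+k] : ∀ k → (suc k + suc k) C k ≡ (suc k + suc k) C suc (suc k)
[2+2k]Ck≡[2+2k]C[2+k] k = subst (λ n → n C k ≡ n C suc (suc k)) (+-suc k (suc k)) ([k+j]Ck≡[k+j]Cj k (suc (suc k)))

[1+k]*[2+2k]C[1+k]≡2*[1+2k]*[2k]Ck : ∀ k → suc k * ((suc k + suc k) C suc k) ≡ 2 * (suc (k + k) * ((k + k) C k))
[1+k]*[2+2k]C[1+k]≡2*[1+2k]*[2k]Ck k = begin
  suc k * ((suc k + suc k) C suc k)                 ≡⟨ cong (λ n → suc k * (n C suc k)) (cong suc (+-suc k k)) ⟩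
  suc k * (suc (suc (k + k)) C suc k)               ≡⟨ cong (suc k *_) (pascal (suc (k + k)) k) ⟩
  suc k * (suc (k + k) C k + suc (k + k) C suc k)   ≡⟨ cong (λ x → suc k * (x + suc (k + k) C suc k)) ([1+2k]Ck≡[1+2k]C[1+k] k) ⟩
  suc k * (Z + Z)                                   ≡⟨ double-inside (suc k) Z ⟩
  2 * (suc k * Z)                                   ≡⟨ cong (2 *_) ([1+k]*[1+n]C[1+k]≡[1+n]*nCk (k + k) k) ⟩
  2 * (suc (k + k) * ((k + k) C k))                 ∎
  where
  open ≡-Reasoning
  Z = suc (k + k) C suc k
  double-inside : ∀ a z → a * (z + z) ≡ 2 * (a * z)
  double-inside = solve-∀

-- Catalan numbers

catalan : ℕ → ℕ
catalan k = (k + k) C k ∸ (k + k) C suc k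

catalan+[2k]C[1+k]≡[2k]Ck : ∀ k → catalan k + (k + k) C suc k ≡ (k + k) C k
catalan+[2k]C[1+k]≡[2k]Ck k = m∸n+n≡m (n≤1+2k⇒nC[1+k]≤nCk k (n≤1+n (k + k)))

[1+k]*catalan≡[2k]Ck : ∀ k → suc k * catalan k ≡ (k + k) C k
[1+k]*catalan≡[2k]Ck k = begin
  suc k * (X ∸ (k + k) C suc k)              ≡⟨ *-distribˡ-∸ (suc k) X ((k + k) C suc k) ⟩
  suc k * X ∸ suc k * ((k + k) C suc k)      ≡⟨ cong (suc k * X ∸_) ([1+k]*nC[1+k]≡[n∸k]*nCk (k + k) k) ⟩
  suc k * X ∸ (k + k ∸ k) * X                ≡⟨ cong (λ j → suc k * X ∸ j * X) (m+n∸m≡n k k) ⟩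
  X + k * X ∸ k * X                          ≡⟨ m+n∸n≡m X (k * X) ⟩
  X                                          ∎
  where
  open ≡-Reasoning
  X = (k + k) C k

[2+k]*catalan[1+k]≡2*[1+2k]*catalan : ∀ k → suc (suc k) * catalan (suc k) ≡ 2 * (suc (k + k) * catalan k)
[2+k]*catalan[1+k]≡2*[1+2k]*catalan k = *-cancelˡ-≡ _ _ (suc k) (begin
  suc k * (suc (suc k) * catalan (suc k))    ≡⟨ cong (suc k *_) ([1+k]*catalan≡[2k]Ck (suc k)) ⟩
  suc k * ((suc k + suc k) C suc k)          ≡⟨ [1+k]*[2+2k]C[1+k]≡2*[1+2k]*[2k]Ck k ⟩
  2 * (suc (k + k) * ((k + k) C k))          ≡⟨ cong (λ x → 2 * (suc (k + k) * x)) ([1+k]*catalan≡[2k]Ck k) ⟨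
  2 * (suc (k + k) * (suc k * catalan k))    ≡⟨ reorder (suc (k + k)) (suc k) (catalan k) ⟩
  suc k * (2 * (suc (k + k) * catalan k))    ∎)
  where
  open ≡-Reasoning
  reorder : ∀ a b c → 2 * (a * (b * c)) ≡ b * (2 * (a * c))
  reorder = solve-∀

2*catalan[1+k]≤catalan[2+k] : ∀ k → 2 * catalan (suc k) ≤ catalan (suc (suc k))
2*catalan[1+k]≤catalan[2+k] k = *-cancelˡ-≤ (suc (suc (suc k))) (begin
  suc (suc (suc k)) * (2 * catalan (suc k))      ≡⟨ reorder (suc (suc (suc k))) (catalan (suc k)) ⟩
  2 * (suc (suc (suc k)) * catalan (suc k))      ≤⟨ *-monoʳ-≤ 2 (*-monoˡ-≤ (catalan (suc k)) (s≤s (s≤s (m≤n+m (suc k) k)))) ⟩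
  2 * (suc (suc k + suc k) * catalan (suc k))    ≡⟨ [2+k]*catalan[1+k]≡2*[1+2k]*catalan (suc k) ⟨
  suc (suc (suc k)) * catalan (suc (suc k))      ∎)
  where
  open ≤-Reasoning
  reorder : ∀ a c → a * (2 * c) ≡ 2 * (a * c)
  reorder = solve-∀

catalanSum : ℕ → ℕ
catalanSum zero = zero
catalanSum (suc k) = catalanSum k + catalan k

catalanSum<catalan : ∀ k → catalanSum k < catalan (suc k)
catalanSum<catalan zero = s≤s z≤n
catalanSum<catalan (suc zero) = s≤s (s≤s z≤n)
catalanSum<catalan (suc (suc k)) = begin-strict
  catalanSum (suc k) + catalan (suc k)           <⟨ +-monoˡ-< (catalan (suc k)) (catalanSum<catalan (suc k)) ⟩
  catalan (suc (suc k)) + catalan (suc k)        ≤⟨ +-monoʳ-≤ (catalan (suc (suc k))) (≤-trans (m≤m+n _ _) (2*catalan[1+k]≤catalan[2+k] k)) ⟩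
  catalan (suc (suc k)) + catalan (suc (suc k))  ≡⟨ cong (λ x → catalan (suc (suc k)) + x) (+-identityʳ _) ⟨
  2 * catalan (suc (suc k))                      ≤⟨ 2*catalan[1+k]≤catalan[2+k] (suc k) ⟩
  catalan (suc (suc (suc k)))                    ∎
  where open ≤-Reasoning

-- Gaps between adjacent binomial coefficients

-- f a + g b ≤ f b + g a says f a - g a ≤ f b - g b, without truncated subtraction.
diff-nondecreasing : ∀ (f g : ℕ → ℕ) {a b} →
  (∀ {x} → a ≤ x → x < b → f x + g (suc x) ≤ f (suc x) + g x) →
  a ≤ b → f a + g b ≤ f b + g a
diff-nondecreasing f g {a} {b} step a≤b = go (≤⇒≤′ a≤b) ≤-refl
  where
  go : ∀ {c} → a ≤′ c → c ≤ b → f a + g c ≤ f c + g a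
  go ≤′-refl _ = ≤-refl
  go {suc c} (≤′-step a≤′c) c<b = +-cancelʳ-≤ (f c + g c) _ _ (begin
    f a + g (suc c) + (f c + g c)       ≡⟨ swap (f a) (g (suc c)) (f c) (g c) ⟩
    (f a + g c) + (f c + g (suc c))     ≤⟨ +-mono-≤ (go a≤′c (<⇒≤ c<b)) (step (≤′⇒≤ a≤′c) c<b) ⟩
    (f c + g a) + (f (suc c) + g c)     ≡⟨ unswap (f c) (g a) (f (suc c)) (g c) ⟩
    f (suc c) + g a + (f c + g c)       ∎)
    where
    open ≤-Reasoning
    swap : ∀ p q r s → p + q + (r + s) ≡ (p + s) + (r + q)
    swap = solve-∀
    unswap : ∀ p q r s → (p + q) + (r + s) ≡ r + q + (p + s)
    unswap = solve-∀

-- C(n, k) - C(n, k+1) increases with n up to n = 2k, where it is the Catalan number.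
nCk≤nC[1+k]+catalan : ∀ n k → n C k ≤ n C suc k + catalan k
nCk≤nC[1+k]+catalan n k with suc (k + k) ≤? n
... | yes 1+2k≤n = ≤-trans (1+2k≤n⇒nCk≤nC[1+k] k 1+2k≤n) (m≤m+n _ _)
... | no 1+2k≰n = +-cancelʳ-≤ X′ _ _ (begin
  n C k + X′                      ≤⟨ diff-nondecreasing (_C k) (_C suc k) (λ _ → step k) (≤-pred (≰⇒> 1+2k≰n)) ⟩
  (k + k) C k + n C suc k         ≡⟨ cong (_+ n C suc k) (catalan+[2k]C[1+k]≡[2k]Ck k) ⟨
  catalan k + X′ + n C suc k      ≡⟨ rearrange (catalan k) X′ (n C suc k) ⟩
  n C suc k + catalan k + X′      ∎)
  where
  open ≤-Reasoning
  X′ = (k + k) C suc k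
  rearrange : ∀ c x y → c + x + y ≡ y + c + x
  rearrange = solve-∀
  step : ∀ k {x} → x < k + k → x C k + suc x C suc k ≤ suc x C k + x C suc k
  step zero ()
  step (suc k) {x} x<2k = begin
    x C suc k + suc x C suc (suc k)                 ≡⟨ cong (_+_ (x C suc k)) (pascal x (suc k)) ⟩
    x C suc k + (x C suc k + x C suc (suc k))       ≤⟨ +-monoˡ-≤ _ (n≤1+2k⇒nC[1+k]≤nCk k (≤-trans (≤-pred x<2k) (≤-reflexive (+-suc k k)))) ⟩
    x C k + (x C suc k + x C suc (suc k))           ≡⟨ +-assoc (x C k) _ _ ⟨
    x C k + x C suc k + x C suc (suc k)             ≡⟨ cong (_+ x C suc (suc k)) (pascal x k) ⟨
    suc x C suc k + x C suc (suc k)                 ∎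

[2+2k]Ck+catalan[1+k]≡[2+2k]C[1+k] : ∀ k → (suc k + suc k) C k + catalan (suc k) ≡ (suc k + suc k) C suc k
[2+2k]Ck+catalan[1+k]≡[2+2k]C[1+k] k = begin
  N C k + catalan (suc k)                ≡⟨ cong (_+ catalan (suc k)) ([2+2k]Ck≡[2+2k]C[2+k] k) ⟩
  N C suc (suc k) + catalan (suc k)      ≡⟨ +-comm (N C suc (suc k)) (catalan (suc k)) ⟩
  catalan (suc k) + N C suc (suc k)      ≡⟨ catalan+[2k]C[1+k]≡[2k]Ck (suc k) ⟩
  N C suc k                              ∎
  where
  open ≡-Reasoning
  N = suc k + suc k

2+2k≤n⇒nCk+catalanSum<nC[1+k] : ∀ k {n} → suc k + suc k ≤ n → n C k + catalanSum k < n C suc k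
2+2k≤n⇒nCk+catalanSum<nC[1+k] k {n} N≤n = begin-strict
  n C k + catalanSum k              <⟨ +-monoʳ-< (n C k) (catalanSum<catalan k) ⟩
  n C k + catalan (suc k)           ≤⟨ +-cancelʳ-≤ (N C k) _ _ (begin
    n C k + catalan (suc k) + N C k   ≡⟨ rearrange (n C k) (catalan (suc k)) (N C k) ⟩
    N C k + catalan (suc k) + n C k   ≡⟨ cong (_+ n C k) ([2+2k]Ck+catalan[1+k]≡[2+2k]C[1+k] k) ⟩
    N C suc k + n C k                 ≤⟨ diff-nondecreasing (_C suc k) (_C k) (λ N≤x _ → step k N≤x) N≤n ⟩
    n C suc k + N C k                 ∎) ⟩
  n C suc k                         ∎
  where
  open ≤-Reasoning
  N = suc k + suc k
  rearrange : ∀ a c b → a + c + b ≡ b + c + a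
  rearrange = solve-∀
  step : ∀ k {x} → suc k + suc k ≤ x → x C suc k + suc x C k ≤ suc x C suc k + x C k
  step zero {x} _ = +-monoˡ-≤ 1 (nCk≤[1+n]Ck x 1)
  step (suc k) {x} N≤x = begin
    x C suc (suc k) + suc x C suc k                 ≡⟨ cong (_+_ (x C suc (suc k))) (pascal x k) ⟩
    x C suc (suc k) + (x C k + x C suc k)           ≤⟨ +-monoʳ-≤ (x C suc (suc k)) (+-monoˡ-≤ (x C suc k) (1+2k≤n⇒nCk≤nC[1+k] k 1+2k≤x)) ⟩
    x C suc (suc k) + (x C suc k + x C suc k)       ≡⟨ rearrange′ (x C suc (suc k)) (x C suc k) ⟩
    (x C suc k + x C suc (suc k)) + x C suc k       ≡⟨ cong (_+ x C suc k) (pascal x (suc k)) ⟨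
    suc x C suc (suc k) + x C suc k                 ∎
    where
    rearrange′ : ∀ r q → r + (q + q) ≡ (q + r) + q
    rearrange′ = solve-∀
    1+2k≤x : suc (k + k) ≤ x
    1+2k≤x = ≤-trans (+-mono-≤ (n≤1+n (suc k)) (≤-trans (n≤1+n k) (n≤1+n (suc k)))) N≤x

-- The greedy binomial representation and the shadow

n<[n+1+k]C[1+k] : ∀ n k → n < (n + suc k) C suc k
n<[n+1+k]C[1+k] n zero = ≤-reflexive (sym (trans (cong (_C 1) (+-comm n 1)) (nC1≡n (suc n))))
n<[n+1+k]C[1+k] n (suc k) = begin-strict
  n                                          <⟨ n<[n+1+k]C[1+k] n k ⟩
  (n + suc k) C suc k                        ≤⟨ m≤m+n _ _ ⟩
  (n + suc k) C suc k + (n + suc k) C suc (suc k)  ≡⟨ pascal (n + suc k) (suc k) ⟨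
  suc (n + suc k) C suc (suc k)              ≡⟨ cong (_C suc (suc k)) (+-suc n (suc k)) ⟨
  (n + suc (suc k)) C suc (suc k)            ∎
  where open ≤-Reasoning

largestA-C≤ : ∀ k m b → largestA (suc k) m b C suc k ≤ m
largestA-C≤ k m zero = z≤n
largestA-C≤ k m (suc b) with suc b C suc k ≤? m
... | yes bC≤m = bC≤m
... | no _ = largestA-C≤ k m b

largestA-maximal : ∀ k m b → m < suc b C suc k → m < suc (largestA (suc k) m b) C suc k
largestA-maximal k m zero m<1C = m<1C
largestA-maximal k m (suc b) m<[2+b]C with suc b C suc k ≤? m
... | yes _ = m<[2+b]C
... | no bC≰m = largestA-maximal k m b (≰⇒> bC≰m)

shadowTerm : ℕ × ℕ → ℕ
shadowTerm (i , a) = a C (i ∸ 1)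

shadow : ℕ → ℕ → ℕ
shadow r m = sum (map shadowTerm (binRep r m))

κ≡shadow-m : ∀ r m → κ r m ≡ + shadow r m - + m
κ≡shadow-m r m = cong (λ xs → + sum xs - + m) (map-cong (λ { (i , a) → refl }) (binRep r m))

record LeadingTerm (k m : ℕ) : Set where
  field
    a rest : ℕ
    m≡aC[1+k]+rest : m ≡ a C suc k + rest
    rest<aCk : rest < a C k
    shadow≡aCk+shadow : shadow (suc k) m ≡ a C k + shadow k rest

  aC[1+k]≤m : a C suc k ≤ m
  aC[1+k]≤m = ≤-trans (m≤m+n _ rest) (≤-reflexive (sym m≡aC[1+k]+rest))

  m<[1+a]C[1+k] : m < suc a C suc k
  m<[1+a]C[1+k] = begin-strict
    m                     ≡⟨ m≡aC[1+k]+rest ⟩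
    a C suc k + rest      <⟨ +-monoʳ-< (a C suc k) rest<aCk ⟩
    a C suc k + a C k     ≡⟨ +-comm (a C suc k) (a C k) ⟩
    a C k + a C suc k     ≡⟨ pascal a k ⟨
    suc a C suc k         ∎
    where open ≤-Reasoning

leadingTerm : ∀ k n → LeadingTerm k (suc n)
leadingTerm k n = record
  { a = a
  ; rest = suc n ∸ a C suc k
  ; m≡aC[1+k]+rest = sym (m+[n∸m]≡n aC≤m)
  ; rest<aCk = +-cancelˡ-< (a C suc k) _ _ (begin-strict
      a C suc k + (suc n ∸ a C suc k)   ≡⟨ m+[n∸m]≡n aC≤m ⟩
      suc n                             <⟨ m<[1+a]C ⟩
      suc a C suc k                     ≡⟨ pascal a k ⟩
      a C k + a C suc k                 ≡⟨ +-comm (a C k) (a C suc k) ⟩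
      a C suc k + a C k                 ∎)
  ; shadow≡aCk+shadow = refl
  }
  where
  open ≤-Reasoning
  a = largestA (suc k) (suc n) (suc n + suc k)
  aC≤m : a C suc k ≤ suc n
  aC≤m = largestA-C≤ k (suc n) (suc n + suc k)
  m<[1+a]C : suc n < suc a C suc k
  m<[1+a]C = largestA-maximal k (suc n) (suc n + suc k)
    (<-≤-trans (n<[n+1+k]C[1+k] (suc n) k) (nCk≤[1+n]Ck (suc n + suc k) (suc k)))

-- Normalized matching: if the k-sets lie in a (k+p)-set, the shadow is at least
-- m · C(k+p, k-1) / C(k+p, k) = m · k / (p+1).
m<[k+p]Ck⇒k*m≤[1+p]*shadow : ∀ k p m → m < (k + p) C k → k * m ≤ suc p * shadow k m
m<[k+p]Ck⇒k*m≤[1+p]*shadow zero p m _ = z≤n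
m<[k+p]Ck⇒k*m≤[1+p]*shadow (suc k) p zero _ = ≤-trans (≤-reflexive (*-zeroʳ (suc k))) z≤n
m<[k+p]Ck⇒k*m≤[1+p]*shadow (suc k) p (suc n) m<[1+k+p]C = begin
  suc k * suc n                           ≡⟨ cong (suc k *_) m≡aC[1+k]+rest ⟩
  suc k * (a C suc k + rest)              ≡⟨ *-distribˡ-+ (suc k) (a C suc k) rest ⟩
  suc k * (a C suc k) + suc k * rest      ≡⟨ cong (_+ suc k * rest) ([1+k]*nC[1+k]≡[n∸k]*nCk a k) ⟩
  p′ * (a C k) + (rest + k * rest)          ≤⟨ +-monoʳ-≤ (p′ * (a C k)) (+-mono-≤ (<⇒≤ rest<aCk) IH) ⟩
  p′ * (a C k) + (a C k + suc p′ * s)       ≡⟨ collect p′ (a C k) s ⟩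
  suc p′ * (a C k + s)                    ≤⟨ *-monoˡ-≤ (a C k + s) (s≤s p′≤p) ⟩
  suc p * (a C k + s)                     ≡⟨ cong (suc p *_) shadow≡aCk+shadow ⟨
  suc p * shadow (suc k) (suc n)          ∎
  where
  open ≤-Reasoning
  open LeadingTerm (leadingTerm k n)
  s = shadow k rest
  p′ = a ∸ k
  k≤a : k ≤ a
  k≤a = ≮⇒≥ (λ a<k → contradiction (subst (rest <_) (k>n⇒nCk≡0 a<k) rest<aCk) λ ())
  a<1+k+p : a < suc k + p
  a<1+k+p = ≰⇒> (λ 1+k+p≤a → <⇒≱ m<[1+k+p]C (≤-trans (C-monoˡ-≤ (suc k) 1+k+p≤a) aC[1+k]≤m))
  a≡k+p′ : a ≡ k + p′
  a≡k+p′ = sym (m+[n∸m]≡n k≤a)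
  p′≤p : p′ ≤ p
  p′≤p = +-cancelˡ-≤ k _ _ (≤-pred (subst (_< suc k + p) a≡k+p′ a<1+k+p))
  IH : k * rest ≤ suc p′ * s
  IH = m<[k+p]Ck⇒k*m≤[1+p]*shadow k p′ rest (subst (λ b → rest < b C k) a≡k+p′ rest<aCk)
  collect : ∀ p x s → p * x + (x + suc p * s) ≡ suc p * (x + s)
  collect = solve-∀

m<[1+2k]C[1+k]⇒m≤shadow : ∀ k m → m < suc (k + k) C suc k → m ≤ shadow (suc k) m
m<[1+2k]C[1+k]⇒m≤shadow k m m<C = *-cancelˡ-≤ (suc k) (m<[k+p]Ck⇒k*m≤[1+p]*shadow (suc k) k m m<C)

shadow≤m+catalanSum : ∀ k m → shadow k m ≤ m + catalanSum k
shadow≤m+catalanSum zero m = z≤n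
shadow≤m+catalanSum (suc k) zero = z≤n
shadow≤m+catalanSum (suc k) (suc n) = begin
  shadow (suc k) (suc n)                            ≡⟨ shadow≡aCk+shadow ⟩
  a C k + shadow k rest                             ≤⟨ +-mono-≤ (nCk≤nC[1+k]+catalan a k) (shadow≤m+catalanSum k rest) ⟩
  (a C suc k + catalan k) + (rest + catalanSum k)   ≡⟨ rearrange (a C suc k) (catalan k) rest (catalanSum k) ⟩
  (a C suc k + rest) + (catalanSum k + catalan k)   ≡⟨ cong (_+ catalanSum (suc k)) m≡aC[1+k]+rest ⟨
  suc n + catalanSum (suc k)                        ∎
  where
  open ≤-Reasoning
  open LeadingTerm (leadingTerm k n)
  rearrange : ∀ b c x y → (b + c) + (x + y) ≡ (b + x) + (y + c)
  rearrange = solve-∀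

sumCentral[1+k]≡sumCentral+[1+2k]C[1+k] : ∀ k → sumCentral (suc k) ≡ sumCentral k + suc (k + k) C suc k
sumCentral[1+k]≡sumCentral+[1+2k]C[1+k] k = cong (λ n → sumCentral k + n C suc k) (2k+1≡1+2k k)
  where
  2k+1≡1+2k : ∀ k → 2 * k + 1 ≡ suc (k + k)
  2k+1≡1+2k = solve-∀

[1+2k]C[1+k]≤sumCentral : ∀ k → suc (k + k) C suc k ≤ sumCentral (suc k)
[1+2k]C[1+k]≤sumCentral k = ≤-trans (m≤n+m _ (sumCentral k)) (≤-reflexive (sym (sumCentral[1+k]≡sumCentral+[1+2k]C[1+k] k)))

sumCentral<[2+2k]C[1+k] : ∀ k → sumCentral (suc k) < (suc k + suc k) C suc k
sumCentral<[2+2k]C[1+k] zero = s≤s (s≤s z≤n)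
sumCentral<[2+2k]C[1+k] (suc k) = begin-strict
  sumCentral (suc (suc k))                         ≡⟨ sumCentral[1+k]≡sumCentral+[1+2k]C[1+k] (suc k) ⟩
  sumCentral (suc k) + M C suc (suc k)             <⟨ +-monoˡ-< (M C suc (suc k)) (sumCentral<[2+2k]C[1+k] k) ⟩
  (suc k + suc k) C suc k + M C suc (suc k)        ≤⟨ +-monoˡ-≤ (M C suc (suc k)) (nCk≤[1+n]Ck (suc k + suc k) (suc k)) ⟩
  M C suc k + M C suc (suc k)                      ≡⟨ pascal M (suc k) ⟨
  suc M C suc (suc k)                              ≡⟨ cong (λ n → suc n C suc (suc k)) (+-suc (suc k) (suc k)) ⟨
  (suc (suc k) + suc (suc k)) C suc (suc k)        ∎
  where
  open ≤-Reasoning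
  M = suc (suc k + suc k)

module _ {k m : ℕ} (L : LeadingTerm k m) where
  open LeadingTerm L

  a<1+2k⇒m<[1+2k]C[1+k] : a < suc (k + k) → m < suc (k + k) C suc k
  a<1+2k⇒m<[1+2k]C[1+k] a<1+2k = <-≤-trans m<[1+a]C[1+k] (C-monoˡ-≤ (suc k) a<1+2k)

  a<1+2k⇒m≤shadow : a < suc (k + k) → m ≤ shadow (suc k) m
  a<1+2k⇒m≤shadow = m<[1+2k]C[1+k]⇒m≤shadow k m ∘ a<1+2k⇒m<[1+2k]C[1+k]

  a<1+2k⇒m≤sumCentral : a < suc (k + k) → m ≤ sumCentral (suc k)
  a<1+2k⇒m≤sumCentral a<1+2k = ≤-trans (<⇒≤ (a<1+2k⇒m<[1+2k]C[1+k] a<1+2k)) ([1+2k]C[1+k]≤sumCentral k)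

  a≡1+2k⇒shadow<m⇔shadow<rest : a ≡ suc (k + k) → shadow (suc k) m < m ⇔ shadow k rest < rest
  a≡1+2k⇒shadow<m⇔shadow<rest a≡1+2k =
    subst₂ (λ x y → x < y ⇔ shadow k rest < rest) (sym shadow≡) (sym m≡aC[1+k]+rest) (+-cancelˡ-<-⇔ (a C suc k))
    where
    aCk≡aC[1+k] : a C k ≡ a C suc k
    aCk≡aC[1+k] = subst (λ b → b C k ≡ b C suc k) (sym a≡1+2k) ([1+2k]Ck≡[1+2k]C[1+k] k)
    shadow≡ : shadow (suc k) m ≡ a C suc k + shadow k rest
    shadow≡ = trans shadow≡aCk+shadow (cong (_+ shadow k rest) aCk≡aC[1+k])

  a≡1+2k⇒sumCentral<m⇔sumCentral<rest : a ≡ suc (k + k) → sumCentral (suc k) < m ⇔ sumCentral k < rest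
  a≡1+2k⇒sumCentral<m⇔sumCentral<rest a≡1+2k =
    subst₂ (λ x y → x < y ⇔ sumCentral k < rest) (sym central≡) (sym m≡aC[1+k]+rest) (+-cancelˡ-<-⇔ (a C suc k))
    where
    central≡ : sumCentral (suc k) ≡ a C suc k + sumCentral k
    central≡ = trans (sumCentral[1+k]≡sumCentral+[1+2k]C[1+k] k)
      (trans (cong (λ b → sumCentral k + b C suc k) (sym a≡1+2k)) (+-comm (sumCentral k) (a C suc k)))

  1+2k<a⇒sumCentral<m : suc (k + k) < a → sumCentral (suc k) < m
  1+2k<a⇒sumCentral<m 1+2k<a = <-≤-trans (sumCentral<[2+2k]C[1+k] k)
    (≤-trans (C-monoˡ-≤ (suc k) (≤-trans (≤-reflexive (cong suc (+-suc k k))) 1+2k<a)) aC[1+k]≤m)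

  1+2k<a⇒shadow<m : suc (k + k) < a → shadow (suc k) m < m
  1+2k<a⇒shadow<m 1+2k<a = begin-strict
    shadow (suc k) m                   ≡⟨ shadow≡aCk+shadow ⟩
    a C k + shadow k rest              ≤⟨ +-monoʳ-≤ (a C k) (shadow≤m+catalanSum k rest) ⟩
    a C k + (rest + catalanSum k)      ≡⟨ rearrange (a C k) rest (catalanSum k) ⟩
    (a C k + catalanSum k) + rest      <⟨ +-monoˡ-< rest (2+2k≤n⇒nCk+catalanSum<nC[1+k] k 2+2k≤a) ⟩
    a C suc k + rest                   ≡⟨ m≡aC[1+k]+rest ⟨
    m                                  ∎
    where
    open ≤-Reasoning
    2+2k≤a : suc k + suc k ≤ a
    2+2k≤a = ≤-trans (≤-reflexive (cong suc (+-suc k k))) 1+2k<a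
    rearrange : ∀ x y z → x + (y + z) ≡ (x + z) + y
    rearrange = solve-∀

shadow<m⇔sumCentral<m : ∀ r m → shadow r m < m ⇔ sumCentral r < m
shadow<m⇔sumCentral<m zero m = ⇔.refl
shadow<m⇔sumCentral<m (suc k) zero = mk⇔ (λ ()) (λ ())
shadow<m⇔sumCentral<m (suc k) (suc n) with leadingTerm k n
... | L with <-cmp (LeadingTerm.a L) (suc (k + k))
... | tri< a<1+2k _ _ = mk⇔ (λ shadow<m → contradiction shadow<m (≤⇒≯ (a<1+2k⇒m≤shadow L a<1+2k)))
                            (λ central<m → contradiction central<m (≤⇒≯ (a<1+2k⇒m≤sumCentral L a<1+2k)))
... | tri≈ _ a≡1+2k _ = ⇔.trans (a≡1+2k⇒shadow<m⇔shadow<rest L a≡1+2k)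
                          (⇔.trans (shadow<m⇔sumCentral<m k (LeadingTerm.rest L))
                                   (⇔.sym (a≡1+2k⇒sumCentral<m⇔sumCentral<rest L a≡1+2k)))
... | tri> _ _ 1+2k<a = mk⇔ (λ _ → 1+2k<a⇒sumCentral<m L 1+2k<a) (λ _ → 1+2k<a⇒shadow<m L 1+2k<a)

proposition2p2 : (r m : ℕ) → 1 ≤ r → ((κ r m <ℤ + 0) ⇔ (suc (sumCentral r) ≤ m))
proposition2p2 r m _ = subst (λ x → (x <ℤ + 0) ⇔ (sumCentral r < m)) (sym (κ≡shadow-m r m))
  (⇔.trans ([+m]-[+n]<0⇔m<n (shadow r m) m) (shadow<m⇔sumCentral<m r m))
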